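{- Let $P_{n_1},\dots,P_{n_r}$ be oriented paths, where $P_{n_i}$ has vertices $a_{i,1}\to a_{i,2}\to\cdots\to a_{i,n_i}$. Let $G=\square_{i=1}^r P_{n_i}$ carry a simple pebbling. Then $G\cong [S_G]$ as directed graphs.
   Context: The Cartesian product $G=\square_{i=1}^r P_{n_i}$ has vertex set all tuples $(x_1,\dots,x_r)$ with $x_i\in\{a_{i,1},\dots,a_{i,n_i}\}$, and a directed edge from $(x_1,\dots,x_r)$ to $(y_1,\dots,y_r)$ iff the tuples agree in all coordinates except one coordinate $i$, where $x_i=a_{i,j}$ and $y_i=a_{i,j+1}$ for some $j$. A simple pebbling on $G$ is a pebbling assignment such that: for each $i$, the vertex whose $i$-th coordinate is $a_{i,1}$ and whose $l$-th coordinate is $a_{l,n_l}$ for all $l\neq i$ has two or three pebbles; for each $i$ and each $1<j<n_i$, the vertex whose $i$-th coordinate is $a_{i,j}$ and whose other coordinates are $a_{l,n_l}$ ($l\neq i$) has exactly one pebble; the vertex $(a_{1,n_1},\dots,a_{r,n_r})$ has any number of pebbles; and every remaining vertex has zero or one pebble. A pebbling move along an edge $(v,w)$ (allowed when $v$ has at least two pebbles) removes two pebbles from $v$ and adds one pebble to $w$. The assignment graph $[S_G]$ is the directed graph whose vertices are all assignments obtainable from $(S_G)$ by finite sequences of pebbling moves (including $(S_G)$ itself), with a directed edge from $A$ to $B$ whenever $B$ is obtained from $A$ by a single pebbling move. -}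

module Defs where

open import Data.Nat using (ℕ; zero; suc; _+_; _∸_; _≤_; _<_)
open import Data.Fin using (Fin)
open import Data.Vec using (Vec; lookup)
open import Data.Vec.Relation.Binary.Pointwise.Inductive using (Pointwise)
open import Data.Product using (Σ; _×_; _,_; proj₁)
open import Data.Sum using (_⊎_)
open import Relation.Nullary using (¬_)
open import Relation.Binary.PropositionalEquality using (_≡_; _≢_)
open import Relation.Binary.Construct.Closure.ReflexiveTransitive using (Star)

-- The i-th oriented path P_{n_i} has n_i = suc (lookup m i)
-- vertices a_{i,1} → … → a_{i,n_i}; vertex a_{i,k+1} is encoded by the
-- natural number k ∈ {0, …, lookup m i}.

module _ {r : ℕ} (m : Vec ℕ r) where

  Vertex : Set
  Vertex = Σ (Vec ℕ r) (λ x → Pointwise _≤_ x m)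

  coord : Vertex → Fin r → ℕ
  coord (x , _) i = lookup x i

  Edge : Vertex → Vertex → Set
  Edge u v = Σ (Fin r) (λ i →
    (coord v i ≡ suc (coord u i)) × (∀ l → l ≢ i → coord u l ≡ coord v l))

  IsTop : Vertex → Set
  IsTop v = proj₁ v ≡ m

  OnAxis : Fin r → Vertex → Set
  OnAxis i v = ∀ l → l ≢ i → coord v l ≡ lookup m l

  Assignment : Set
  Assignment = Vertex → ℕ

  record SimplePebbling (S : Assignment) : Set where
    field
      start  : ∀ i v → OnAxis i v → coord v i ≡ 0 → (S v ≡ 2) ⊎ (S v ≡ 3)
      middle : ∀ i v → OnAxis i v → 0 < coord v i → coord v i < lookup m i → S v ≡ 1
      rest   : ∀ v → (∀ i → ¬ OnAxis i v) → ¬ IsTop v → S v ≤ 1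

  Move : Assignment → Assignment → Set
  Move A B = Σ Vertex (λ u → Σ Vertex (λ v →
    Edge u v × (2 ≤ A u) × (B u ≡ A u ∸ 2) × (B v ≡ A v + 1)
      × (∀ w → w ≢ u → w ≢ v → B w ≡ A w)))

  -- vertices of the assignment graph [S_G]: assignments reachable by
  -- finitely many pebbling moves (including S itself); its edges are Move.
  Reachable : Assignment → Assignment → Set
  Reachable S A = Star Move S A

  _≗ₐ_ : Assignment → Assignment → Set
  A ≗ₐ B = ∀ v → A v ≡ B v

  -- G ≅ [S_G]: a map f from vertices of G onto the vertices of [S_G]
  -- (assignments taken up to extensional equality), injective, and with
  -- u → v in G iff f u → f v in [S_G].
  IsoToAssignmentGraph : Assignment → Set
  IsoToAssignmentGraph S = Σ (Vertex → Assignment) (λ f →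
      (∀ v → Reachable S (f v))
    × (∀ A → Reachable S A → Σ Vertex (λ v → f v ≗ₐ A))
    × (∀ u v → f u ≗ₐ f v → u ≡ v)
    × (∀ u v → (Edge u v → Move (f u) (f v)) × (Move (f u) (f v) → Edge u v)))

{-# OPTIONS --safe #-}
-- A vertex v of the grid is sent to the assignment obtained from S by pushing,
-- on every axis i, the front pebbles v_i steps along that axis.  In such an
-- assignment the only vertices that can fire (two or more pebbles, and an
-- out-edge, so not the top) are the current fronts of the unfinished axes, and
-- firing the front of axis i yields the image of the successor of v in
-- direction i.  So the moves out of the image of v are exactly the edges out of
-- v, and the positions of the fronts recover v.
module Submission where

open import Defs
open import Data.Nat using (ℕ; zero; suc; pred; >-nonZero; _+_; _*_; _∸_; _≤_; _<_; z≤n; z<s; s<s; _≤?_; _<?_; _≟_)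
open import Data.Nat.Properties
open import Algebra.Properties.CommutativeMonoid.Sum +-0-commutativeMonoid
  using (sum; sum-cong-≗; sum-replicate-zero; sum-remove)
open import Data.Fin using (Fin) renaming (_≟_ to _≟ᶠ_)
open import Data.Fin.Properties using (all?; any?; punchInᵢ≢i)
open import Data.Vec using (Vec; lookup; replicate; _[_]≔_)
open import Data.Vec.Properties using (lookup∘update; lookup∘update′; lookup-replicate)
open import Data.Vec.Functional using (Vector; removeAt)
open import Data.Vec.Relation.Binary.Pointwise.Inductive as Pointwise
  using (Pointwise; []; _∷_; Pointwise-≡⇒≡)
open import Data.Vec.Relation.Binary.Pointwise.Extensional using (ext; extensional⇒inductive)
open import Data.Product using (Σ; _×_; _,_; proj₁; proj₂)
open import Data.Sum using (inj₁; inj₂)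
open import Function using (_∘_)
open import Relation.Nullary using (Dec; yes; no; ¬_; contradiction; ¬?)
open import Relation.Nullary.Decidable using (_×-dec_; _→-dec_)
open import Relation.Binary.Definitions using (DecidableEquality; tri<; tri≈; tri>)
open import Relation.Binary.PropositionalEquality
open import Relation.Binary.Construct.Closure.ReflexiveTransitive using (Star; ε; _◅_; _◅◅_; gmap)

indicator : {P : Set} → Dec P → ℕ
indicator (yes _) = 1
indicator (no _)  = 0

indicator-yes : {P : Set} (d : Dec P) → P → indicator d ≡ 1
indicator-yes (yes _) _ = refl
indicator-yes (no ¬p) p = contradiction p ¬p

indicator-no : {P : Set} (d : Dec P) → ¬ P → indicator d ≡ 0
indicator-no (yes p) ¬p = contradiction p ¬p
indicator-no (no _)  _  = refl

indicator-cong : {P Q : Set} (d : Dec P) (e : Dec Q) → (P → Q) → (Q → P) → indicator d ≡ indicator e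
indicator-cong (yes p) e P⇒Q _   = sym (indicator-yes e (P⇒Q p))
indicator-cong (no ¬p) e _   Q⇒P = sym (indicator-no e (¬p ∘ Q⇒P))

sum-zero : ∀ {n} (g : Vector ℕ n) → (∀ i → g i ≡ 0) → sum g ≡ 0
sum-zero {n} g g≗0 = trans (sum-cong-≗ g≗0) (sum-replicate-zero n)

sum-single : ∀ {n} (g : Vector ℕ n) i → (∀ j → j ≢ i → g j ≡ 0) → sum g ≡ g i
sum-single {suc n} g i others = begin
  sum g                    ≡⟨ sum-remove {i = i} g ⟩
  g i + sum (removeAt g i) ≡⟨ cong (g i +_) (sum-zero _ (λ j → others _ (punchInᵢ≢i i j))) ⟩
  g i + 0                  ≡⟨ +-identityʳ (g i) ⟩
  g i                      ∎
  where open ≡-Reasoning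

sum-step : ∀ {n} (g h : Vector ℕ n) i → (∀ j → j ≢ i → g j ≡ h j) → h i ≡ suc (g i) →
           sum h ≡ suc (sum g)
sum-step {suc n} g h i same step = begin
  sum h                          ≡⟨ sum-remove {i = i} h ⟩
  h i + sum (removeAt h i)       ≡⟨ cong₂ _+_ step (sum-cong-≗ (λ j → sym (same _ (punchInᵢ≢i i j)))) ⟩
  suc (g i + sum (removeAt g i)) ≡⟨ cong suc (sum-remove {i = i} g) ⟨
  suc (sum g)                    ∎
  where open ≡-Reasoning

Pointwise-≤-irrelevant : ∀ {n} {xs ys : Vec ℕ n} (p q : Pointwise _≤_ xs ys) → p ≡ q
Pointwise-≤-irrelevant []       []       = refl
Pointwise-≤-irrelevant (a ∷ p) (b ∷ q) = cong₂ _∷_ (≤-irrelevant a b) (Pointwise-≤-irrelevant p q)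

Transfer : {V : Set} → (V → ℕ) → (V → ℕ) → V → V → Set
Transfer A B p q = (B p ≡ A p ∸ 2) × (B q ≡ A q + 1) × (∀ w → w ≢ p → w ≢ q → B w ≡ A w)

Transfer-functional : {V : Set} → DecidableEquality V → ∀ {A B C : V → ℕ} {p q} →
                      Transfer A B p q → Transfer A C p q → B ≗ C
Transfer-functional _≟ᵥ_ {p = p} {q} (Bp , Bq , B-rest) (Cp , Cq , C-rest) w with w ≟ᵥ p | w ≟ᵥ q
... | yes refl | _        = trans Bp (sym Cp)
... | no w≢p   | yes refl = trans Bq (sym Cq)
... | no w≢p   | no w≢q   = trans (B-rest w w≢p w≢q) (sym (C-rest w w≢p w≢q))

Transfer-resp-≗ : {V : Set} {A A′ B B′ : V → ℕ} {p q : V} → A ≗ A′ → B ≗ B′ →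
                  Transfer A B p q → Transfer A′ B′ p q
Transfer-resp-≗ {p = p} {q} A≗A′ B≗B′ (Bp , Bq , B-rest) =
  trans (sym (B≗B′ p)) (trans Bp (cong (_∸ 2) (A≗A′ p))) ,
  trans (sym (B≗B′ q)) (trans Bq (cong (_+ 1) (A≗A′ q))) ,
  λ w w≢p w≢q → trans (sym (B≗B′ w)) (trans (B-rest w w≢p w≢q) (A≗A′ w))

module Grid {r : ℕ} (m : Vec ℕ r) where

  V : Set
  V = Vertex m

  M : Fin r → ℕ
  M = lookup m

  infixl 9 _‼_
  _‼_ : V → Fin r → ℕ
  _‼_ = coord m

  ‼-bounded : ∀ v i → v ‼ i ≤ M i
  ‼-bounded (_ , x≤m) = Pointwise.lookup x≤m

  vertex-ext : ∀ u v → (∀ i → u ‼ i ≡ v ‼ i) → u ≡ v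
  vertex-ext (x , x≤m) (y , y≤m) same with Pointwise-≡⇒≡ {xs = x} {ys = y} (extensional⇒inductive (ext same))
  ... | refl = cong (x ,_) (Pointwise-≤-irrelevant x≤m y≤m)

  _≟ᵥ_ : DecidableEquality V
  u ≟ᵥ v with all? (λ i → u ‼ i ≟ v ‼ i)
  ... | yes same = yes (vertex-ext u v same)
  ... | no ¬same = no (λ u≡v → ¬same (λ i → cong (_‼ i) u≡v))

  Move-resp-≗ : ∀ {A A′ B B′} → A ≗ A′ → B ≗ B′ → Move m A B → Move m A′ B′
  Move-resp-≗ A≗A′ B≗B′ (p , q , p→q , heavy , transfer) =
    p , q , p→q , subst (2 ≤_) (A≗A′ p) heavy , Transfer-resp-≗ A≗A′ B≗B′ transfer

  setCoord : (v : V) (i : Fin r) (k : ℕ) → k ≤ M i → V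
  setCoord (x , x≤m) i k k≤M = x [ i ]≔ k , extensional⇒inductive (ext bounded)
    where
    bounded : ∀ l → lookup (x [ i ]≔ k) l ≤ M l
    bounded l with l ≟ᶠ i
    ... | yes refl = subst (_≤ M i) (sym (lookup∘update i x k)) k≤M
    ... | no l≢i   = subst (_≤ M l) (sym (lookup∘update′ l≢i x k)) (Pointwise.lookup x≤m l)

  setCoord-‼-same : ∀ v i k k≤M → setCoord v i k k≤M ‼ i ≡ k
  setCoord-‼-same (x , _) i k _ = lookup∘update i x k

  setCoord-‼-other : ∀ v i k k≤M {l} → l ≢ i → setCoord v i k k≤M ‼ l ≡ v ‼ l
  setCoord-‼-other (x , _) i k _ l≢i = lookup∘update′ l≢i x k

  advance : (u : V) (i : Fin r) → u ‼ i < M i → Σ V (Edge m u)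
  advance u i u<M =
    setCoord u i (suc (u ‼ i)) u<M ,
    i , setCoord-‼-same u i _ u<M , (λ l l≢i → sym (setCoord-‼-other u i _ u<M l≢i))

  retreat : (v : V) (i : Fin r) → 1 ≤ v ‼ i → Σ V (λ u → Edge m u v)
  retreat v i pos =
    u , i , trans (sym (suc-pred (v ‼ i) {{>-nonZero pos}})) (cong suc (sym (setCoord-‼-same v i _ pred≤M))) ,
    (λ l l≢i → setCoord-‼-other v i _ pred≤M l≢i)
    where
    pred≤M = ≤-trans pred[n]≤n (‼-bounded v i)
    u = setCoord v i (pred (v ‼ i)) pred≤M

  top : V
  top = m , Pointwise.refl ≤-refl

  axisPoint : (i : Fin r) (k : ℕ) → k ≤ M i → V
  axisPoint = setCoord top

  axisPoint-onAxis : ∀ i k k≤M → OnAxis m i (axisPoint i k k≤M)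
  axisPoint-onAxis i k k≤M l = setCoord-‼-other top i k k≤M

  axisPoint-‼ : ∀ i k k≤M → axisPoint i k k≤M ‼ i ≡ k
  axisPoint-‼ = setCoord-‼-same top

  onAxis-injective : ∀ i u w → OnAxis m i u → OnAxis m i w → u ‼ i ≡ w ‼ i → u ≡ w
  onAxis-injective i u w u-on w-on same-i = vertex-ext u w same
    where
    same : ∀ l → u ‼ l ≡ w ‼ l
    same l with l ≟ᶠ i
    ... | yes refl = same-i
    ... | no l≢i   = trans (u-on l l≢i) (sym (w-on l l≢i))

  onAxis-unique : ∀ {i l} w → w ‼ i < M i → l ≢ i → ¬ OnAxis m l w
  onAxis-unique {i} w w<M l≢i w-on = <-irrefl (w-on i (l≢i ∘ sym)) w<M

  onAxis-dominates : ∀ {i} v w → OnAxis m i w → v ‼ i ≤ w ‼ i → ∀ l → v ‼ l ≤ w ‼ l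
  onAxis-dominates {i} v w w-on v≤w l with l ≟ᶠ i
  ... | yes refl = v≤w
  ... | no l≢i   = subst (v ‼ l ≤_) (sym (w-on l l≢i)) (‼-bounded v l)

  Edge-alongAxis : ∀ i p q → OnAxis m i p → OnAxis m i q → q ‼ i ≡ suc (p ‼ i) → Edge m p q
  Edge-alongAxis i p q p-on q-on step = i , step , λ l l≢i → trans (p-on l l≢i) (sym (q-on l l≢i))

  origin : V
  origin = replicate r 0 , extensional⇒inductive (ext λ i → subst (_≤ M i) (sym (lookup-replicate i 0)) z≤n)

  origin-‼ : ∀ i → origin ‼ i ≡ 0
  origin-‼ i = lookup-replicate i 0

  height : V → ℕ
  height v = sum (v ‼_)

  height-Edge : ∀ u v → Edge m u v → height v ≡ suc (height u)
  height-Edge u v (i , step , same) = sum-step (u ‼_) (v ‼_) i same step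

  reachable-from-origin : ∀ v → Star (Edge m) origin v
  reachable-from-origin v = descend (height v) v refl
    where
    descend : ∀ n v → height v ≡ n → Star (Edge m) origin v
    descend n v h with any? (λ i → 1 ≤? v ‼ i)
    descend n v h | no ¬pos = subst (Star (Edge m) origin) (vertex-ext origin v zeros) ε
      where
      zeros : ∀ i → origin ‼ i ≡ v ‼ i
      zeros i = trans (origin-‼ i) (sym (n<1⇒n≡0 (≰⇒> (¬pos ∘ (i ,_)))))
    descend n v h | yes (i , pos) with retreat v i pos
    descend zero    v h | yes _ | u , u→v = contradiction (trans (sym (height-Edge u v u→v)) h) (0≢1+n ∘ sym)
    descend (suc n) v h | yes _ | u , u→v =
      descend n u (suc-injective (trans (sym (height-Edge u v u→v)) h)) ◅◅ (u→v ◅ ε)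

module Pebbling {r : ℕ} (m : Vec ℕ r) (S : Assignment m) (simple : SimplePebbling m S) where
  open Grid m
  open SimplePebbling simple

  onAxis? : ∀ i w → Dec (OnAxis m i w)
  onAxis? i w = all? (λ l → ¬? (l ≟ᶠ i) →-dec (w ‼ l ≟ M l))

  receivedOn sentOn : Fin r → ℕ → V → ℕ
  receivedOn i c w = indicator (onAxis? i w ×-dec (1 ≤? w ‼ i ×-dec w ‼ i ≤? c))
  sentOn     i c w = indicator (onAxis? i w ×-dec w ‼ i <? c)

  received sent : V → V → ℕ
  received v w = sum (λ i → receivedOn i (v ‼ i) w)
  sent     v w = sum (λ i → sentOn i (v ‼ i) w)

  -- The front of axis i has advanced v ‼ i steps: each axis vertex behind it has
  -- sent two pebbles and each one up to it, except the start, has received one.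
  -- A vertex w with w ‼ i < M i lies on the i-th axis at most, so at most one
  -- summand is nonzero there; the top lies on every axis.
  shifted : V → Assignment m
  shifted v w = (S w + received v w) ∸ 2 * sent v w

  start-≥2 : ∀ i w → OnAxis m i w → w ‼ i ≡ 0 → 2 ≤ S w
  start-≥2 i w on at-start with start i w on at-start
  ... | inj₁ two   = ≤-reflexive (sym two)
  ... | inj₂ three = ≤-trans (n≤1+n 2) (≤-reflexive (sym three))

  start-≤3 : ∀ i w → OnAxis m i w → w ‼ i ≡ 0 → S w ≤ 3
  start-≤3 i w on at-start with start i w on at-start
  ... | inj₁ two   = ≤-trans (≤-reflexive two) (n≤1+n 2)
  ... | inj₂ three = ≤-reflexive three

  shifted-offAxes : ∀ v w → (∀ l → ¬ OnAxis m l w) → shifted v w ≡ S w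
  shifted-offAxes v w off = trans
    (cong₂ (λ a b → (S w + a) ∸ 2 * b)
      (sum-zero _ (λ l → indicator-no _ (off l ∘ proj₁)))
      (sum-zero _ (λ l → indicator-no _ (off l ∘ proj₁))))
    (+-identityʳ (S w))

  hasReceived : ℕ → ℕ → ℕ
  hasReceived k c = indicator (1 ≤? k ×-dec k ≤? c)

  shifted-onAxis : ∀ v w i → OnAxis m i w → w ‼ i < M i →
    shifted v w ≡ (S w + hasReceived (w ‼ i) (v ‼ i)) ∸ 2 * indicator (w ‼ i <? v ‼ i)
  shifted-onAxis v w i on w<M = cong₂ (λ a b → (S w + a) ∸ 2 * b) received-single sent-single
    where
    received-single : received v w ≡ hasReceived (w ‼ i) (v ‼ i)
    received-single =
      trans (sum-single (λ l → receivedOn l (v ‼ l) w) i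
                        (λ l l≢i → indicator-no _ (onAxis-unique w w<M l≢i ∘ proj₁)))
            (indicator-cong _ _ proj₂ (on ,_))
    sent-single : sent v w ≡ indicator (w ‼ i <? v ‼ i)
    sent-single =
      trans (sum-single (λ l → sentOn l (v ‼ l) w) i
                        (λ l l≢i → indicator-no _ (onAxis-unique w w<M l≢i ∘ proj₁)))
            (indicator-cong _ _ proj₂ (on ,_))

  front-heavy : ∀ v w i → OnAxis m i w → w ‼ i ≡ v ‼ i → v ‼ i < M i → 2 ≤ shifted v w
  front-heavy v w i on at-front v<M = subst (2 ≤_) (sym value) (base (1 ≤? w ‼ i))
    where
    w<M = subst (_< M i) (sym at-front) v<M
    value : shifted v w ≡ S w + hasReceived (w ‼ i) (v ‼ i)
    value = trans (shifted-onAxis v w i on w<M)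
                  (cong (λ b → (S w + hasReceived (w ‼ i) (v ‼ i)) ∸ 2 * b)
                        (indicator-no (w ‼ i <? v ‼ i) (<-irrefl at-front)))
    base : Dec (1 ≤ w ‼ i) → 2 ≤ S w + hasReceived (w ‼ i) (v ‼ i)
    base (yes pos) = ≤-reflexive (sym (cong₂ _+_ (middle i w on pos w<M)
                                                 (indicator-yes _ (pos , ≤-reflexive at-front))))
    base (no ¬pos) = ≤-trans (start-≥2 i w on (n<1⇒n≡0 (≰⇒> ¬pos))) (m≤m+n _ _)

  passed-light : ∀ v w i → OnAxis m i w → w ‼ i < v ‼ i → shifted v w ≤ 1
  passed-light v w i on behind = subst (_≤ 1) (sym value) (base (1 ≤? w ‼ i))
    where
    w<M = <-≤-trans behind (‼-bounded v i)
    value : shifted v w ≡ (S w + hasReceived (w ‼ i) (v ‼ i)) ∸ 2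
    value = trans (shifted-onAxis v w i on w<M)
                  (cong (λ b → (S w + hasReceived (w ‼ i) (v ‼ i)) ∸ 2 * b)
                        (indicator-yes (w ‼ i <? v ‼ i) behind))
    base : Dec (1 ≤ w ‼ i) → (S w + hasReceived (w ‼ i) (v ‼ i)) ∸ 2 ≤ 1
    base (yes pos) = subst (λ t → t ∸ 2 ≤ 1)
      (sym (cong₂ _+_ (middle i w on pos w<M) (indicator-yes _ (pos , <⇒≤ behind)))) z≤n
    base (no ¬pos) = subst (λ t → t ∸ 2 ≤ 1)
      (sym (trans (cong (S w +_) (indicator-no _ (¬pos ∘ proj₁))) (+-identityʳ (S w))))
      (∸-monoˡ-≤ 2 (start-≤3 i w on (n<1⇒n≡0 (≰⇒> ¬pos))))

  ahead-light : ∀ v w i → OnAxis m i w → v ‼ i < w ‼ i → w ‼ i < M i → shifted v w ≤ 1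
  ahead-light v w i on ahead w<M = ≤-reflexive (begin
    shifted v w
      ≡⟨ shifted-onAxis v w i on w<M ⟩
    (S w + hasReceived (w ‼ i) (v ‼ i)) ∸ 2 * indicator (w ‼ i <? v ‼ i)
      ≡⟨ cong₂ (λ a b → (S w + a) ∸ 2 * b) (indicator-no (1 ≤? w ‼ i ×-dec w ‼ i ≤? v ‼ i) (<⇒≱ ahead ∘ proj₂))
                                            (indicator-no (w ‼ i <? v ‼ i) (<⇒≱ ahead ∘ <⇒≤)) ⟩
    S w + 0
      ≡⟨ +-identityʳ (S w) ⟩
    S w
      ≡⟨ middle i w on (≤-trans z<s ahead) w<M ⟩
    1 ∎)
    where open ≡-Reasoning

  heavy⇒front : ∀ v w i → w ‼ i < M i → 2 ≤ shifted v w → OnAxis m i w × w ‼ i ≡ v ‼ i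
  heavy⇒front v w i w<M heavy with onAxis? i w
  ... | no off = contradiction (rest w offAll notTop) (<⇒≱ (subst (2 ≤_) (shifted-offAxes v w offAll) heavy))
    where
    offAll : ∀ l → ¬ OnAxis m l w
    offAll l with l ≟ᶠ i
    ... | yes refl = off
    ... | no l≢i   = onAxis-unique w w<M l≢i
    notTop : ¬ IsTop m w
    notTop w≡m = <-irrefl (cong (λ x → lookup x i) w≡m) w<M
  ... | yes on with <-cmp (w ‼ i) (v ‼ i)
  ...   | tri< behind _ _ = contradiction (passed-light v w i on behind) (<⇒≱ heavy)
  ...   | tri≈ _ at-front _ = on , at-front
  ...   | tri> _ _ ahead = contradiction (ahead-light v w i on ahead w<M) (<⇒≱ heavy)

  sent-dominated : ∀ v w → (∀ l → v ‼ l ≤ w ‼ l) → sent v w ≡ 0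
  sent-dominated v w v≤w =
    sum-zero (λ l → sentOn l (v ‼ l) w) (λ l → indicator-no _ (λ (_ , w<v) → <⇒≱ w<v (v≤w l)))

  module _ (u u′ : V) (i : Fin r) (step : u′ ‼ i ≡ suc (u ‼ i)) (same : ∀ l → l ≢ i → u ‼ l ≡ u′ ‼ l) where

    private
      u≤u′ : u ‼ i ≤ u′ ‼ i
      u≤u′ = subst (u ‼ i ≤_) (sym step) (n≤1+n _)

    shifted-source : ∀ p → OnAxis m i p → p ‼ i ≡ u ‼ i → shifted u′ p ≡ shifted u p ∸ 2
    shifted-source p on at = begin
      shifted u′ p
        ≡⟨ shifted-onAxis u′ p i on p<M ⟩
      (S p + hasReceived (p ‼ i) (u′ ‼ i)) ∸ 2 * indicator (p ‼ i <? u′ ‼ i)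
        ≡⟨ cong₂ (λ a b → (S p + a) ∸ 2 * b) received-same (indicator-yes (p ‼ i <? u′ ‼ i) p<u′) ⟩
      (S p + hasReceived (p ‼ i) (u ‼ i)) ∸ 2
        ≡⟨ cong (λ b → ((S p + hasReceived (p ‼ i) (u ‼ i)) ∸ 2 * b) ∸ 2)
                (indicator-no (p ‼ i <? u ‼ i) (<-irrefl at)) ⟨
      ((S p + hasReceived (p ‼ i) (u ‼ i)) ∸ 2 * indicator (p ‼ i <? u ‼ i)) ∸ 2
        ≡⟨ cong (_∸ 2) (shifted-onAxis u p i on p<M) ⟨
      shifted u p ∸ 2 ∎
      where
      open ≡-Reasoning
      p<u′ : p ‼ i < u′ ‼ i
      p<u′ = subst (p ‼ i <_) (sym step) (s<s (≤-reflexive at))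
      p<M = <-≤-trans p<u′ (‼-bounded u′ i)
      received-same : hasReceived (p ‼ i) (u′ ‼ i) ≡ hasReceived (p ‼ i) (u ‼ i)
      received-same = indicator-cong _ _ (λ (pos , _) → pos , ≤-reflexive at)
                                         (λ (pos , p≤u) → pos , ≤-trans p≤u u≤u′)

    shifted-target : ∀ q → OnAxis m i q → q ‼ i ≡ u′ ‼ i → shifted u′ q ≡ shifted u q + 1
    shifted-target q on at = begin
      shifted u′ q
        ≡⟨ cong₂ (λ a b → (S q + a) ∸ 2 * b) received-step
                 (sent-dominated u′ q (onAxis-dominates u′ q on (≤-reflexive (sym at)))) ⟩
      S q + suc (received u q)
        ≡⟨ +-suc (S q) (received u q) ⟩
      suc (S q + received u q)
        ≡⟨ +-comm (S q + received u q) 1 ⟨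
      (S q + received u q) + 1
        ≡⟨ cong (λ b → ((S q + received u q) ∸ 2 * b) + 1)
                (sent-dominated u q (onAxis-dominates u q on (≤-trans u≤u′ (≤-reflexive (sym at))))) ⟨
      shifted u q + 1 ∎
      where
      open ≡-Reasoning
      received-step : received u′ q ≡ suc (received u q)
      received-step = sum-step (λ l → receivedOn l (u ‼ l) q) (λ l → receivedOn l (u′ ‼ l) q) i
        (λ l l≢i → cong (λ c → receivedOn l c q) (same l l≢i))
        (trans (indicator-yes _ (on , subst (1 ≤_) (sym (trans at step)) z<s , ≤-reflexive at))
               (cong suc (sym (indicator-no _
                 (λ (_ , _ , q≤u) → 1+n≰n (subst (_≤ u ‼ i) (trans at step) q≤u))))))

    shifted-elsewhere : ∀ p q → OnAxis m i p → p ‼ i ≡ u ‼ i → OnAxis m i q → q ‼ i ≡ u′ ‼ i →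
                        ∀ w → w ≢ p → w ≢ q → shifted u′ w ≡ shifted u w
    shifted-elsewhere p q p-on p-at q-on q-at w w≢p w≢q =
      cong₂ (λ a b → (S w + a) ∸ 2 * b) (sum-cong-≗ received-same) (sum-cong-≗ sent-same)
      where
      w≢u′ : OnAxis m i w → w ‼ i ≢ u′ ‼ i
      w≢u′ on w≡u′ = w≢q (onAxis-injective i w q on q-on (trans w≡u′ (sym q-at)))
      w≢u : OnAxis m i w → w ‼ i ≢ u ‼ i
      w≢u on w≡u = w≢p (onAxis-injective i w p on p-on (trans w≡u (sym p-at)))
      received-same : ∀ l → receivedOn l (u′ ‼ l) w ≡ receivedOn l (u ‼ l) w
      received-same l with l ≟ᶠ i
      ... | no l≢i   = cong (λ c → receivedOn l c w) (sym (same l l≢i))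
      ... | yes refl = indicator-cong _ _
        (λ (on , pos , w≤u′) → on , pos , ≤-pred (subst (w ‼ i <_) step (≤∧≢⇒< w≤u′ (w≢u′ on))))
        (λ (on , pos , w≤u) → on , pos , ≤-trans w≤u u≤u′)
      sent-same : ∀ l → sentOn l (u′ ‼ l) w ≡ sentOn l (u ‼ l) w
      sent-same l with l ≟ᶠ i
      ... | no l≢i   = cong (λ c → sentOn l c w) (sym (same l l≢i))
      ... | yes refl = indicator-cong _ _
        (λ (on , w<u′) → on , ≤∧≢⇒< (≤-pred (subst (w ‼ i <_) step w<u′)) (w≢u on))
        (λ (on , w<u) → on , <-≤-trans w<u u≤u′)

    shifted-transfer : ∀ p q → OnAxis m i p → p ‼ i ≡ u ‼ i → OnAxis m i q → q ‼ i ≡ u′ ‼ i →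
                       Transfer (shifted u) (shifted u′) p q
    shifted-transfer p q p-on p-at q-on q-at =
      shifted-source p p-on p-at , shifted-target q q-on q-at , shifted-elsewhere p q p-on p-at q-on q-at

  shifted-Move : ∀ u u′ → Edge m u u′ → Move m (shifted u) (shifted u′)
  shifted-Move u u′ (i , step , same) =
    p , q , Edge-alongAxis i p q p-on q-on (trans q-at (trans step (cong suc (sym p-at)))) ,
    front-heavy u p i p-on p-at u<M , shifted-transfer u u′ i step same p q p-on p-at q-on q-at
    where
    u<M = subst (_≤ M i) step (‼-bounded u′ i)
    p = axisPoint i (u ‼ i) (<⇒≤ u<M)
    q = axisPoint i (u′ ‼ i) (‼-bounded u′ i)
    p-on = axisPoint-onAxis i (u ‼ i) (<⇒≤ u<M)
    q-on = axisPoint-onAxis i (u′ ‼ i) (‼-bounded u′ i)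
    p-at = axisPoint-‼ i (u ‼ i) (<⇒≤ u<M)
    q-at = axisPoint-‼ i (u′ ‼ i) (‼-bounded u′ i)

  shifted-Move⁻ : ∀ u {B} → Move m (shifted u) B → Σ V (λ u′ → Edge m u u′ × shifted u′ ≗ B)
  shifted-Move⁻ u (p , q , (j , q-step , q-same) , heavy , transfer) =
    u′ , u→u′ , Transfer-functional _≟ᵥ_ (shifted-transfer u u′ j step same p q p-on p-at q-on q-at) transfer
    where
    p<M : p ‼ j < M j
    p<M = subst (_≤ M j) q-step (‼-bounded q j)
    front = heavy⇒front u p j p<M heavy
    p-on = proj₁ front
    p-at = proj₂ front
    next = advance u j (subst (_< M j) p-at p<M)
    u′ = proj₁ next
    u→u′ = proj₂ next
    step = proj₁ (proj₂ u→u′)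
    same = proj₂ (proj₂ u→u′)
    q-on : OnAxis m j q
    q-on l l≢j = trans (sym (q-same l l≢j)) (p-on l l≢j)
    q-at : q ‼ j ≡ u′ ‼ j
    q-at = trans q-step (trans (cong suc p-at) (sym step))

  shifted-injective : ∀ u v → shifted u ≗ shifted v → u ≡ v
  shifted-injective u v shifted≗ = vertex-ext u v coords
    where
    front-coord : ∀ u v → shifted u ≗ shifted v → ∀ i → u ‼ i < M i → u ‼ i ≡ v ‼ i
    front-coord u v shifted≗ i u<M =
      trans (sym p-at) (proj₂ (heavy⇒front v p i (subst (_< M i) (sym p-at) u<M)
                                           (subst (2 ≤_) (shifted≗ p) (front-heavy u p i p-on p-at u<M))))
      where
      p = axisPoint i (u ‼ i) (<⇒≤ u<M)
      p-on = axisPoint-onAxis i (u ‼ i) (<⇒≤ u<M)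
      p-at = axisPoint-‼ i (u ‼ i) (<⇒≤ u<M)
    coords : ∀ i → u ‼ i ≡ v ‼ i
    coords i with m≤n⇒m<n∨m≡n (‼-bounded u i) | m≤n⇒m<n∨m≡n (‼-bounded v i)
    ... | inj₁ u<M | _        = front-coord u v shifted≗ i u<M
    ... | inj₂ _   | inj₁ v<M = sym (front-coord v u (sym ∘ shifted≗) i v<M)
    ... | inj₂ u≡M | inj₂ v≡M = trans u≡M (sym v≡M)

  shifted-origin : shifted origin ≗ S
  shifted-origin w = trans
    (cong₂ (λ a b → (S w + a) ∸ 2 * b)
      (sum-zero (λ l → receivedOn l (origin ‼ l) w)
                (λ l → indicator-no _ (λ (_ , pos , w≤0) → <⇒≱ pos (subst (w ‼ l ≤_) (origin-‼ l) w≤0))))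
      (sent-dominated origin w (λ l → subst (_≤ w ‼ l) (sym (origin-‼ l)) z≤n)))
    (+-identityʳ (S w))

  -- Reachable S A without moves forces A ≡ S, and _≡_ on functions is not
  -- extensional, so the origin must be sent to S itself, not just to shifted origin ≗ S.
  φ : V → Assignment m
  φ v with v ≟ᵥ origin
  ... | yes _ = S
  ... | no _  = shifted v

  φ-origin : φ origin ≡ S
  φ-origin with origin ≟ᵥ origin
  ... | yes _     = refl
  ... | no ≢origin = contradiction refl ≢origin

  φ≗shifted : ∀ v → φ v ≗ shifted v
  φ≗shifted v w with v ≟ᵥ origin
  ... | yes refl = sym (shifted-origin w)
  ... | no _     = refl

  φ-Move : ∀ {u u′} → Edge m u u′ → Move m (φ u) (φ u′)
  φ-Move {u} {u′} u→u′ = Move-resp-≗ (sym ∘ φ≗shifted u) (sym ∘ φ≗shifted u′) (shifted-Move u u′ u→u′)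

  φ-reachable : ∀ v → Reachable m S (φ v)
  φ-reachable v = subst (λ A → Star (Move m) A (φ v)) φ-origin (gmap φ φ-Move (reachable-from-origin v))

  reachable⇒image : ∀ u {A B} → φ u ≗ A → Star (Move m) A B → Σ V (λ v → φ v ≗ B)
  reachable⇒image u φu≗A ε = u , φu≗A
  reachable⇒image u φu≗A (move ◅ moves)
    with shifted-Move⁻ u (Move-resp-≗ (λ w → trans (sym (φu≗A w)) (φ≗shifted u w)) (λ _ → refl) move)
  ... | u′ , _ , shifted≗ = reachable⇒image u′ (λ w → trans (φ≗shifted u′ w) (shifted≗ w)) moves

  φ-injective : ∀ u v → φ u ≗ φ v → u ≡ v
  φ-injective u v φ≗ = shifted-injective u v (λ w → trans (sym (φ≗shifted u w)) (trans (φ≗ w) (φ≗shifted v w)))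

  φ-Move⁻ : ∀ u v → Move m (φ u) (φ v) → Edge m u v
  φ-Move⁻ u v move with shifted-Move⁻ u (Move-resp-≗ (φ≗shifted u) (λ _ → refl) move)
  ... | u′ , u→u′ , shifted≗ =
    subst (Edge m u) (φ-injective u′ v (λ w → trans (φ≗shifted u′ w) (shifted≗ w))) u→u′

theorem7p1 : {r : ℕ} (m : Vec ℕ r) (S : Assignment m) → SimplePebbling m S → IsoToAssignmentGraph m S
theorem7p1 m S simple =
  φ , φ-reachable , (λ A → reachable⇒image origin (cong-app φ-origin)) , φ-injective , (λ u v → φ-Move , φ-Move⁻ u v)
  where
  open Grid m
  open Pebbling m S simple
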